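{- (Equivalence between $\mathrm{NLT}_{\omega}$ and $\mathrm{SLT}_{\omega}$.) For every formula $\alpha$, the sequent $\Rightarrow\alpha$ (empty antecedent) is derivable in $\mathrm{SLT}_{\omega}$ if and only if $\alpha$ is provable in $\mathrm{NLT}_{\omega}$, i.e. there is a derivation in $\mathrm{NLT}_{\omega}$ with no open assumptions whose end-formula is $\alpha$.
   Context: Formulas are built from countably many propositional variables using binary $\to,\wedge,\vee$ and unary $\neg,\mathrm{G},\mathrm{F},\mathrm{X}$; $\mathrm{X}^0\alpha:=\alpha$, $\mathrm{X}^{n+1}\alpha:=\mathrm{X}^n\mathrm{X}\alpha$. In all rules below $i,j,k$ are arbitrary natural numbers. $\mathrm{SLT}_{\omega}$: sequents $\Gamma\Rightarrow\gamma$, $\Gamma$ a finite set of formulas, $\gamma$ a formula or empty; derivations are well-founded, possibly infinitely branching trees. Initial sequents $\mathrm{X}^ip,\Gamma\Rightarrow\mathrm{X}^ip$ ($p$ a propositional variable). Rules: (cut) from $\Gamma\Rightarrow\alpha$ and $\alpha,\Sigma\Rightarrow\gamma$ infer $\Gamma,\Sigma\Rightarrow\gamma$; (we-right) from $\Gamma\Rightarrow$ infer $\Gamma\Rightarrow\alpha$; ($\to$left) from $\Gamma\Rightarrow\mathrm{X}^i\alpha$ and $\mathrm{X}^i\beta,\Gamma\Rightarrow\gamma$ infer $\mathrm{X}^i(\alpha\to\beta),\Gamma\Rightarrow\gamma$; ($\to$right) from $\mathrm{X}^i\alpha,\Gamma\Rightarrow\mathrm{X}^i\beta$ infer $\Gamma\Rightarrow\mathrm{X}^i(\alpha\to\beta)$;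 ($\neg$left) from $\Gamma\Rightarrow\mathrm{X}^i\alpha$ infer $\mathrm{X}^i\neg\alpha,\Gamma\Rightarrow$; ($\neg$right) from $\mathrm{X}^i\alpha,\Gamma\Rightarrow$ infer $\Gamma\Rightarrow\mathrm{X}^i\neg\alpha$; (ex-middle) from $\mathrm{X}^i\neg\alpha,\Gamma\Rightarrow\gamma$ and $\mathrm{X}^i\alpha,\Gamma\Rightarrow\gamma$ infer $\Gamma\Rightarrow\gamma$; ($\wedge$left) from $\mathrm{X}^i\alpha,\mathrm{X}^i\beta,\Gamma\Rightarrow\gamma$ infer $\mathrm{X}^i(\alpha\wedge\beta),\Gamma\Rightarrow\gamma$; ($\wedge$right) from $\Gamma\Rightarrow\mathrm{X}^i\alpha$ and $\Gamma\Rightarrow\mathrm{X}^i\beta$ infer $\Gamma\Rightarrow\mathrm{X}^i(\alpha\wedge\beta)$; ($\vee$left) from $\mathrm{X}^i\alpha,\Gamma\Rightarrow\gamma$ and $\mathrm{X}^i\beta,\Gamma\Rightarrow\gamma$ infer $\mathrm{X}^i(\alpha\vee\beta),\Gamma\Rightarrow\gamma$; ($\vee$right1/2) from $\Gamma\Rightarrow\mathrm{X}^i\alpha$ (resp. $\Gamma\Rightarrow\mathrm{X}^i\beta$) infer $\Gamma\Rightarrow\mathrm{X}^i(\alpha\vee\beta)$; (Gleft) from $\mathrm{X}^{i+k}\alpha,\Gamma\Rightarrow\gamma$ infer $\mathrm{X}^i\mathrm{G}\alpha,\Gamma\Rightarrow\gamma$; (Gright) from all $\Gamma\Rightarrow\mathrm{X}^{i+j}\alpha$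 ($j\in\omega$) infer $\Gamma\Rightarrow\mathrm{X}^i\mathrm{G}\alpha$; (Fleft) from all $\mathrm{X}^{i+j}\alpha,\Gamma\Rightarrow\gamma$ ($j\in\omega$) infer $\mathrm{X}^i\mathrm{F}\alpha,\Gamma\Rightarrow\gamma$; (Fright) from $\Gamma\Rightarrow\mathrm{X}^{i+k}\alpha$ infer $\Gamma\Rightarrow\mathrm{X}^i\mathrm{F}\alpha$. $\mathrm{NLT}_{\omega}$ is a natural deduction system (derivations are well-founded, possibly infinitely branching trees of formulas, with assumptions that may be discharged, $[\cdot]$ marking discharged assumptions) with rules: ($\to$I) from a derivation of $\mathrm{X}^i\beta$ infer $\mathrm{X}^i(\alpha\to\beta)$ discharging $\mathrm{X}^i\alpha$ (discharge may be vacuous); ($\to$E) from $\mathrm{X}^i(\alpha\to\beta)$ and $\mathrm{X}^i\alpha$ infer $\mathrm{X}^i\beta$; (EXP) from $\mathrm{X}^i\neg\alpha$ and $\mathrm{X}^i\alpha$ infer any $\gamma$; (EXM) from a derivation of $\gamma$ from $[\mathrm{X}^i\neg\alpha]$ and a derivation of $\gamma$ from $[\mathrm{X}^i\alpha]$ infer $\gamma$, discharging both; ($\neg$I) from a derivation of $\mathrm{X}^j\neg\gamma$ from $[\mathrm{X}^i\alpha]$ and a derivation of $\mathrm{X}^j\gamma$ from $[\mathrm{X}^i\alpha]$ infer $\mathrm{X}^i\neg\alpha$; ($\wedge$I) from $\mathrm{X}^i\alpha$ and $\mathrm{X}^i\beta$ infer $\mathrm{X}^i(\alpha\wedge\beta)$;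 ($\wedge$E1/2) from $\mathrm{X}^i(\alpha\wedge\beta)$ infer $\mathrm{X}^i\alpha$ (resp. $\mathrm{X}^i\beta$); ($\vee$I1/2) from $\mathrm{X}^i\alpha$ (resp. $\mathrm{X}^i\beta$) infer $\mathrm{X}^i(\alpha\vee\beta)$; ($\vee$E) from $\mathrm{X}^i(\alpha\vee\beta)$, a derivation of $\gamma$ from $[\mathrm{X}^i\alpha]$ and a derivation of $\gamma$ from $[\mathrm{X}^i\beta]$ infer $\gamma$; (GI) from all $\mathrm{X}^{i+j}\alpha$ ($j\in\omega$) infer $\mathrm{X}^i\mathrm{G}\alpha$; (GE) from $\mathrm{X}^i\mathrm{G}\alpha$ infer $\mathrm{X}^{i+k}\alpha$; (FI) from $\mathrm{X}^{i+k}\alpha$ infer $\mathrm{X}^i\mathrm{F}\alpha$; (FE) from $\mathrm{X}^i\mathrm{F}\alpha$ and, for every $j\in\omega$, a derivation of $\gamma$ from $[\mathrm{X}^{i+j}\alpha]$, infer $\gamma$. -}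

module Defs where

open import Data.Nat using (ℕ; zero; suc; _+_)
open import Data.List using (List; []; _∷_; _++_)
open import Data.List.Membership.Propositional using (_∈_)
open import Data.List.Relation.Binary.BagAndSetEquality using (_∼[_]_; set)
open import Data.Maybe using (Maybe; just; nothing)

data Fml : Set where
  var : ℕ → Fml
  _⇒_ _∧_ _∨_ : Fml → Fml → Fml
  ¬_ G F X : Fml → Fml

Xⁿ : ℕ → Fml → Fml
Xⁿ zero    a = a
Xⁿ (suc n) a = Xⁿ n (X a)

-- Antecedents are finite sets, represented as lists; the rule
-- `set-eq` identifies lists with the same elements (so derivability is
-- exactly derivability of the underlying finite-set sequents).
-- Succedent: `just γ` or `nothing` (empty).

data SLT : List Fml → Maybe Fml → Set where
  set-eq   : ∀ {Γ Δ γ} → Γ ∼[ set ] Δ → SLT Γ γ → SLT Δ γ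
  init     : ∀ {i p Γ} → SLT (Xⁿ i (var p) ∷ Γ) (just (Xⁿ i (var p)))
  cut      : ∀ {Γ Σ a γ} → SLT Γ (just a) → SLT (a ∷ Σ) γ → SLT (Γ ++ Σ) γ
  we-right : ∀ {Γ a} → SLT Γ nothing → SLT Γ (just a)
  ⇒left    : ∀ {i a b Γ γ} → SLT Γ (just (Xⁿ i a)) → SLT (Xⁿ i b ∷ Γ) γ →
             SLT (Xⁿ i (a ⇒ b) ∷ Γ) γ
  ⇒right   : ∀ {i a b Γ} → SLT (Xⁿ i a ∷ Γ) (just (Xⁿ i b)) →
             SLT Γ (just (Xⁿ i (a ⇒ b)))
  ¬left    : ∀ {i a Γ} → SLT Γ (just (Xⁿ i a)) → SLT (Xⁿ i (¬ a) ∷ Γ) nothing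
  ¬right   : ∀ {i a Γ} → SLT (Xⁿ i a ∷ Γ) nothing → SLT Γ (just (Xⁿ i (¬ a)))
  ex-middle : ∀ {i a Γ γ} → SLT (Xⁿ i (¬ a) ∷ Γ) γ → SLT (Xⁿ i a ∷ Γ) γ → SLT Γ γ
  ∧left    : ∀ {i a b Γ γ} → SLT (Xⁿ i a ∷ Xⁿ i b ∷ Γ) γ → SLT (Xⁿ i (a ∧ b) ∷ Γ) γ
  ∧right   : ∀ {i a b Γ} → SLT Γ (just (Xⁿ i a)) → SLT Γ (just (Xⁿ i b)) →
             SLT Γ (just (Xⁿ i (a ∧ b)))
  ∨left    : ∀ {i a b Γ γ} → SLT (Xⁿ i a ∷ Γ) γ → SLT (Xⁿ i b ∷ Γ) γ →
             SLT (Xⁿ i (a ∨ b) ∷ Γ) γ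
  ∨right1  : ∀ {i a b Γ} → SLT Γ (just (Xⁿ i a)) → SLT Γ (just (Xⁿ i (a ∨ b)))
  ∨right2  : ∀ {i a b Γ} → SLT Γ (just (Xⁿ i b)) → SLT Γ (just (Xⁿ i (a ∨ b)))
  Gleft    : ∀ {i k a Γ γ} → SLT (Xⁿ (i + k) a ∷ Γ) γ → SLT (Xⁿ i (G a) ∷ Γ) γ
  Gright   : ∀ {i a Γ} → ((j : ℕ) → SLT Γ (just (Xⁿ (i + j) a))) →
             SLT Γ (just (Xⁿ i (G a)))
  Fleft    : ∀ {i a Γ γ} → ((j : ℕ) → SLT (Xⁿ (i + j) a ∷ Γ) γ) →
             SLT (Xⁿ i (F a) ∷ Γ) γ
  Fright   : ∀ {i k a Γ} → SLT Γ (just (Xⁿ (i + k) a)) → SLT Γ (just (Xⁿ i (F a)))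

-- NLT_ω.  `NLT Γ φ` : there is a derivation of φ all of whose open
-- (undischarged) assumptions belong to Γ.  Discharge = moving the
-- assumption into the context of the premise (possibly vacuously).

data NLT (Γ : List Fml) : Fml → Set where
  assm : ∀ {φ} → φ ∈ Γ → NLT Γ φ
  ⇒I   : ∀ {i a b} → NLT (Xⁿ i a ∷ Γ) (Xⁿ i b) → NLT Γ (Xⁿ i (a ⇒ b))
  ⇒E   : ∀ {i a b} → NLT Γ (Xⁿ i (a ⇒ b)) → NLT Γ (Xⁿ i a) → NLT Γ (Xⁿ i b)
  EXP  : ∀ {i a c} → NLT Γ (Xⁿ i (¬ a)) → NLT Γ (Xⁿ i a) → NLT Γ c
  EXM  : ∀ {i a c} → NLT (Xⁿ i (¬ a) ∷ Γ) c → NLT (Xⁿ i a ∷ Γ) c → NLT Γ c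
  ¬I   : ∀ {i j a c} → NLT (Xⁿ i a ∷ Γ) (Xⁿ j (¬ c)) → NLT (Xⁿ i a ∷ Γ) (Xⁿ j c) →
         NLT Γ (Xⁿ i (¬ a))
  ∧I   : ∀ {i a b} → NLT Γ (Xⁿ i a) → NLT Γ (Xⁿ i b) → NLT Γ (Xⁿ i (a ∧ b))
  ∧E1  : ∀ {i a b} → NLT Γ (Xⁿ i (a ∧ b)) → NLT Γ (Xⁿ i a)
  ∧E2  : ∀ {i a b} → NLT Γ (Xⁿ i (a ∧ b)) → NLT Γ (Xⁿ i b)
  ∨I1  : ∀ {i a b} → NLT Γ (Xⁿ i a) → NLT Γ (Xⁿ i (a ∨ b))
  ∨I2  : ∀ {i a b} → NLT Γ (Xⁿ i b) → NLT Γ (Xⁿ i (a ∨ b))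
  ∨E   : ∀ {i a b c} → NLT Γ (Xⁿ i (a ∨ b)) → NLT (Xⁿ i a ∷ Γ) c →
         NLT (Xⁿ i b ∷ Γ) c → NLT Γ c
  GI   : ∀ {i a} → ((j : ℕ) → NLT Γ (Xⁿ (i + j) a)) → NLT Γ (Xⁿ i (G a))
  GE   : ∀ {i k a} → NLT Γ (Xⁿ i (G a)) → NLT Γ (Xⁿ (i + k) a)
  FI   : ∀ {i k a} → NLT Γ (Xⁿ (i + k) a) → NLT Γ (Xⁿ i (F a))
  FE   : ∀ {i a c} → NLT Γ (Xⁿ i (F a)) → ((j : ℕ) → NLT (Xⁿ (i + j) a ∷ Γ) c) →
         NLT Γ c

SLT-derivable : Fml → Set
SLT-derivable a = SLT [] (just a)

NLT-provable : Fml → Set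
NLT-provable a = NLT [] a

{-# OPTIONS --safe #-}
module Submission where

-- A sequent Γ ⇒ γ becomes a natural-deduction derivation of γ from
-- the assumptions Γ: right rules are introduction rules, and a left rule is the
-- matching elimination rule applied to its principal assumption, followed by a
-- cut, which is admissible in NLT_ω as ⇒I followed by ⇒E.  Conversely,
-- introduction rules are right rules, and an elimination rule is a cut of its
-- major premise against the matching left rule; the identity sequents that this
-- needs for compound formulas are derivable by induction on the formula.

open import Defs
open import Data.Product using (_×_; _,_)
open import Data.Nat using (suc; _+_)
open import Data.List using (List; _∷_)
open import Data.List.Membership.Propositional using (_∈_)
open import Data.List.Relation.Unary.Any using (here; there)
open import Data.List.Relation.Binary.Subset.Propositional using (_⊆_)
open import Data.List.Relation.Binary.Subset.Propositional.Properties
  using (⊆-refl; xs⊆x∷xs; ∷⁺ʳ; ∈-∷⁺ʳ; xs⊆xs++ys; xs⊆ys++xs)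
open import Data.List.Relation.Binary.Permutation.Propositional using (↭-refl; ↭-swap)
open import Data.List.Relation.Binary.BagAndSetEquality
  using (bag-=⇒; ↭⇒∼bag; ++-idempotent)
open import Data.Maybe using (Maybe; just; fromMaybe)
open import Function.Bundles using (mk⇔; Equivalence)
open import Relation.Binary.PropositionalEquality using (refl)

private
  variable
    Γ Δ : List Fml
    φ ψ χ : Fml
    γ : Maybe Fml

NLT-weaken : Γ ⊆ Δ → NLT Γ φ → NLT Δ φ
NLT-weaken Γ⊆Δ (assm φ∈Γ)     = assm (Γ⊆Δ φ∈Γ)
NLT-weaken Γ⊆Δ (⇒I {i} d)     = ⇒I {i = i} (NLT-weaken (∷⁺ʳ _ Γ⊆Δ) d)
NLT-weaken Γ⊆Δ (⇒E {i} d e)   = ⇒E {i = i} (NLT-weaken Γ⊆Δ d) (NLT-weaken Γ⊆Δ e)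
NLT-weaken Γ⊆Δ (EXP {i} d e)  = EXP {i = i} (NLT-weaken Γ⊆Δ d) (NLT-weaken Γ⊆Δ e)
NLT-weaken Γ⊆Δ (EXM {i} d e)  =
  EXM {i = i} (NLT-weaken (∷⁺ʳ _ Γ⊆Δ) d) (NLT-weaken (∷⁺ʳ _ Γ⊆Δ) e)
NLT-weaken Γ⊆Δ (¬I {i} {j} d e) =
  ¬I {i = i} {j} (NLT-weaken (∷⁺ʳ _ Γ⊆Δ) d) (NLT-weaken (∷⁺ʳ _ Γ⊆Δ) e)
NLT-weaken Γ⊆Δ (∧I {i} d e)   = ∧I {i = i} (NLT-weaken Γ⊆Δ d) (NLT-weaken Γ⊆Δ e)
NLT-weaken Γ⊆Δ (∧E1 {i} d)    = ∧E1 {i = i} (NLT-weaken Γ⊆Δ d)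
NLT-weaken Γ⊆Δ (∧E2 {i} d)    = ∧E2 {i = i} (NLT-weaken Γ⊆Δ d)
NLT-weaken Γ⊆Δ (∨I1 {i} d)    = ∨I1 {i = i} (NLT-weaken Γ⊆Δ d)
NLT-weaken Γ⊆Δ (∨I2 {i} d)    = ∨I2 {i = i} (NLT-weaken Γ⊆Δ d)
NLT-weaken Γ⊆Δ (∨E {i} d e f) =
  ∨E {i = i} (NLT-weaken Γ⊆Δ d) (NLT-weaken (∷⁺ʳ _ Γ⊆Δ) e) (NLT-weaken (∷⁺ʳ _ Γ⊆Δ) f)
NLT-weaken Γ⊆Δ (GI {i} d)     = GI {i = i} (λ j → NLT-weaken Γ⊆Δ (d j))
NLT-weaken Γ⊆Δ (GE {i} d)     = GE {i = i} (NLT-weaken Γ⊆Δ d)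
NLT-weaken Γ⊆Δ (FI {i} d)     = FI {i = i} (NLT-weaken Γ⊆Δ d)
NLT-weaken Γ⊆Δ (FE {i} d e)   =
  FE {i = i} (NLT-weaken Γ⊆Δ d) (λ j → NLT-weaken (∷⁺ʳ _ Γ⊆Δ) (e j))

NLT-weaken-under : NLT (φ ∷ Γ) χ → NLT (φ ∷ ψ ∷ Γ) χ
NLT-weaken-under = NLT-weaken (∷⁺ʳ _ (xs⊆x∷xs _ _))

NLT-cut : NLT Γ φ → NLT (φ ∷ Γ) χ → NLT Γ χ
NLT-cut d e = ⇒E {i = 0} (⇒I {i = 0} e) d

-- An empty succedent is read as "every formula": NLT_ω has no falsum, and EXP
-- derives every formula from a contradiction.
SLT⇒NLT : SLT Γ γ → (χ : Fml) → NLT Γ (fromMaybe χ γ)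
SLT⇒NLT (set-eq Γ∼Δ d)      χ = NLT-weaken (Equivalence.to Γ∼Δ) (SLT⇒NLT d χ)
SLT⇒NLT init                χ = assm (here refl)
SLT⇒NLT (cut {Γ} {Σ} d e)   χ =
  NLT-cut (NLT-weaken (xs⊆xs++ys Γ Σ) (SLT⇒NLT d χ))
          (NLT-weaken (∷⁺ʳ _ (xs⊆ys++xs Σ Γ)) (SLT⇒NLT e χ))
SLT⇒NLT (we-right {a = φ} d) χ = SLT⇒NLT d φ
SLT⇒NLT (⇒left {i} d e)     χ =
  NLT-cut (⇒E {i = i} (assm (here refl)) (NLT-weaken (xs⊆x∷xs _ _) (SLT⇒NLT d χ)))
          (NLT-weaken-under (SLT⇒NLT e χ))
SLT⇒NLT (⇒right {i} d)      χ = ⇒I {i = i} (SLT⇒NLT d χ)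
SLT⇒NLT (¬left {i} d)       χ =
  EXP {i = i} (assm (here refl)) (NLT-weaken (xs⊆x∷xs _ _) (SLT⇒NLT d χ))
SLT⇒NLT (¬right {i} d)      χ = ¬I {i = i} {0} (SLT⇒NLT d (¬ var 0)) (SLT⇒NLT d (var 0))
SLT⇒NLT (ex-middle {i} d e) χ = EXM {i = i} (SLT⇒NLT d χ) (SLT⇒NLT e χ)
SLT⇒NLT (∧left {i} d)       χ =
  NLT-cut (∧E2 {i = i} (assm (here refl)))
          (NLT-cut (∧E1 {i = i} (assm (there (here refl))))
                   (NLT-weaken (∷⁺ʳ _ (∷⁺ʳ _ (xs⊆x∷xs _ _))) (SLT⇒NLT d χ)))
SLT⇒NLT (∧right {i} d e)    χ = ∧I {i = i} (SLT⇒NLT d χ) (SLT⇒NLT e χ)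
SLT⇒NLT (∨left {i} d e)     χ =
  ∨E {i = i} (assm (here refl)) (NLT-weaken-under (SLT⇒NLT d χ)) (NLT-weaken-under (SLT⇒NLT e χ))
SLT⇒NLT (∨right1 {i} d)     χ = ∨I1 {i = i} (SLT⇒NLT d χ)
SLT⇒NLT (∨right2 {i} d)     χ = ∨I2 {i = i} (SLT⇒NLT d χ)
SLT⇒NLT (Gleft {i} {k} d)   χ =
  NLT-cut (GE {i = i} {k} (assm (here refl))) (NLT-weaken-under (SLT⇒NLT d χ))
SLT⇒NLT (Gright {i} d)      χ = GI {i = i} (λ j → SLT⇒NLT (d j) χ)
SLT⇒NLT (Fleft {i} d)       χ =
  FE {i = i} (assm (here refl)) (λ j → NLT-weaken-under (SLT⇒NLT (d j) χ))
SLT⇒NLT (Fright {i} d)      χ = FI {i = i} (SLT⇒NLT d χ)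

SLT-exchange : SLT (φ ∷ ψ ∷ Γ) γ → SLT (ψ ∷ φ ∷ Γ) γ
SLT-exchange = set-eq (bag-=⇒ (↭⇒∼bag (↭-swap _ _ ↭-refl)))

SLT-contract : φ ∈ Γ → SLT (φ ∷ Γ) γ → SLT Γ γ
SLT-contract {Γ = Γ} φ∈Γ = set-eq (mk⇔ (∈-∷⁺ʳ φ∈Γ ⊆-refl) (xs⊆x∷xs Γ _))

SLT-cut : SLT Γ (just φ) → SLT (φ ∷ Γ) γ → SLT Γ γ
SLT-cut {Γ} d e = set-eq (++-idempotent Γ) (cut d e)

-- Xⁿ i (X φ) is Xⁿ (suc i) φ by definition, so the X case only shifts i.
SLT-initⁿ : ∀ φ i → SLT (Xⁿ i φ ∷ Γ) (just (Xⁿ i φ))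
SLT-initⁿ (var p) i = init {i}
SLT-initⁿ (φ ⇒ ψ) i = ⇒right {i} (SLT-exchange (⇒left {i} (SLT-initⁿ φ i) (SLT-initⁿ ψ i)))
SLT-initⁿ (φ ∧ ψ) i = ∧left {i} (∧right {i} (SLT-initⁿ φ i) (SLT-exchange (SLT-initⁿ ψ i)))
SLT-initⁿ (φ ∨ ψ) i = ∨left {i} (∨right1 {i} (SLT-initⁿ φ i)) (∨right2 {i} (SLT-initⁿ ψ i))
SLT-initⁿ (¬ φ)   i = ¬right {i} (SLT-exchange (¬left {i} (SLT-initⁿ φ i)))
SLT-initⁿ (G φ)   i = Gright {i} (λ j → Gleft {i} {j} (SLT-initⁿ φ (i + j)))
SLT-initⁿ (F φ)   i = Fleft {i} (λ j → Fright {i} {j} (SLT-initⁿ φ (i + j)))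
SLT-initⁿ (X φ)   i = SLT-initⁿ φ (suc i)

SLT-init : SLT (φ ∷ Γ) (just φ)
SLT-init {φ} = SLT-initⁿ φ 0

NLT⇒SLT : NLT Γ φ → SLT Γ (just φ)
NLT⇒SLT (assm φ∈Γ)     = SLT-contract φ∈Γ SLT-init
NLT⇒SLT (⇒I {i} d)     = ⇒right {i} (NLT⇒SLT d)
NLT⇒SLT (⇒E {i} d e)   = SLT-cut (NLT⇒SLT d) (⇒left {i} (NLT⇒SLT e) SLT-init)
NLT⇒SLT (EXP {i} d e)  = SLT-cut (NLT⇒SLT d) (we-right (¬left {i} (NLT⇒SLT e)))
NLT⇒SLT (EXM {i} d e)  = ex-middle {i} (NLT⇒SLT d) (NLT⇒SLT e)
NLT⇒SLT (¬I {i} {j} d e) = ¬right {i} (SLT-cut (NLT⇒SLT d) (¬left {j} (NLT⇒SLT e)))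
NLT⇒SLT (∧I {i} d e)   = ∧right {i} (NLT⇒SLT d) (NLT⇒SLT e)
NLT⇒SLT (∧E1 {i} d)    = SLT-cut (NLT⇒SLT d) (∧left {i} SLT-init)
NLT⇒SLT (∧E2 {i} d)    = SLT-cut (NLT⇒SLT d) (∧left {i} (SLT-exchange SLT-init))
NLT⇒SLT (∨I1 {i} d)    = ∨right1 {i} (NLT⇒SLT d)
NLT⇒SLT (∨I2 {i} d)    = ∨right2 {i} (NLT⇒SLT d)
NLT⇒SLT (∨E {i} d e f) = SLT-cut (NLT⇒SLT d) (∨left {i} (NLT⇒SLT e) (NLT⇒SLT f))
NLT⇒SLT (GI {i} d)     = Gright {i} (λ j → NLT⇒SLT (d j))
NLT⇒SLT (GE {i} {k} d) = SLT-cut (NLT⇒SLT d) (Gleft {i} {k} SLT-init)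
NLT⇒SLT (FI {i} d)     = Fright {i} (NLT⇒SLT d)
NLT⇒SLT (FE {i} d e)   = SLT-cut (NLT⇒SLT d) (Fleft {i} (λ j → NLT⇒SLT (e j)))

theorem3 : (α : Fml) → (SLT-derivable α → NLT-provable α) × (NLT-provable α → SLT-derivable α)
theorem3 α = (λ d → SLT⇒NLT d α) , NLT⇒SLT
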